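{- Let $s(n)$ be the number of permutations of $[n]$ avoiding each of the patterns $2413$, $3142$, $2143$, $3412$. Then $$\sum_{n\ge0}s(n+1)x^n = \frac{1-2x}{1-4x+2x^2}.$$
   Context: A permutation $\sigma$ of $[n]$ (written in one-line notation) contains a pattern $\tau$ of length $k$ if some subsequence of $\sigma$ of length $k$ is order-isomorphic to $\tau$; otherwise $\sigma$ avoids $\tau$. -}

module Defs where

open import Data.Nat using (ℕ; zero; suc; _∸_; _<_)
open import Data.Fin using (Fin)
import Data.Fin as F
open import Data.Vec using (Vec; lookup; []; _∷_)
open import Data.Integer using (ℤ; +_; -[1+_]) renaming (_+_ to _+ℤ_; _*_ to _*ℤ_)
open import Data.List using (List; foldr; map; upTo; length)
open import Data.List.Membership.Propositional using (_∈_)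
open import Data.List.Relation.Unary.Unique.Propositional using (Unique)
open import Data.Product using (Σ; _×_; ∃-syntax)
open import Function.Bundles using (_⇔_)
open import Function.Definitions using (Injective)
open import Relation.Binary.PropositionalEquality using (_≡_)

-- A permutation of [n] in one-line notation: a vector of length n over Fin n
-- (values 0..n-1) whose lookup map is injective (hence bijective).
IsPerm : ∀ {n} → Vec (Fin n) n → Set
IsPerm σ = Injective _≡_ _≡_ (lookup σ)

Contains : ∀ {n k} → Vec (Fin n) n → Vec (Fin k) k → Set
Contains {n} {k} σ τ =
  Σ (Fin k → Fin n) λ f →
    (∀ i j → i F.< j → f i F.< f j) ×
    (∀ i j → (lookup σ (f i) F.< lookup σ (f j)) ⇔ (lookup τ i F.< lookup τ j))

Avoids : ∀ {n k} → Vec (Fin n) n → Vec (Fin k) k → Set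
Avoids σ τ = Contains σ τ → Data.Empty.⊥
  where import Data.Empty

-- patterns in 0-based one-line notation
p2413 p3142 p2143 p3412 : Vec (Fin 4) 4
p2413 = F.suc F.zero ∷ F.suc (F.suc (F.suc F.zero)) ∷ F.zero ∷ F.suc (F.suc F.zero) ∷ []
p3142 = F.suc (F.suc F.zero) ∷ F.zero ∷ F.suc (F.suc (F.suc F.zero)) ∷ F.suc F.zero ∷ []
p2143 = F.suc F.zero ∷ F.zero ∷ F.suc (F.suc (F.suc F.zero)) ∷ F.suc (F.suc F.zero) ∷ []
p3412 = F.suc (F.suc F.zero) ∷ F.suc (F.suc (F.suc F.zero)) ∷ F.zero ∷ F.suc F.zero ∷ []

Counted : ∀ n → Vec (Fin n) n → Set
Counted n σ = IsPerm σ × Avoids σ p2413 × Avoids σ p3142 × Avoids σ p2143 × Avoids σ p3412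

HasCount : ℕ → ℕ → Set
HasCount n k = ∃[ L ] (Unique L × (∀ σ → (σ ∈ L) ⇔ Counted n σ) × length L ≡ k)

Series : Set
Series = ℕ → ℤ

sumℤ : List ℤ → ℤ
sumℤ = foldr _+ℤ_ (+ 0)

_⊛_ : Series → Series → Series
(f ⊛ g) n = sumℤ (map (λ i → f i *ℤ g (n ∸ i)) (upTo (suc n)))

numer : Series
numer 0 = + 1
numer 1 = -[1+ 1 ]
numer (suc (suc _)) = + 0

denom : Series
denom 0 = + 1
denom 1 = -[1+ 3 ]
denom 2 = + 2
denom (suc (suc (suc _))) = + 0

-- A permutation avoiding 2413, 3142, 2143 and 3412 has an extreme value (minimum or
-- maximum) at one of its ends: otherwise its first and last entries, together with the
-- entries 1 and n, form one of these four patterns.  Conversely every pattern starts and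
-- ends with an interior value, so putting an extreme value in front of (or behind) an
-- avoiding permutation keeps it avoiding.  Sorting the permutations of length n + 2 by
-- whether the first entry is extreme, and otherwise by the last entry, gives
-- s(n+2) = 2 s(n+1) + 2 (s(n+1) - s(n)); with s(0) = s(1) = 1 this is exactly
-- (1 - 4x + 2x²) Σ s(n+1) xⁿ = 1 - 2x.
module Submission where

open import Defs
open import Data.Nat using (ℕ; suc)
open import Data.Integer using (+_)
open import Relation.Binary.PropositionalEquality using (_≡_)

open import Data.Empty using (⊥; ⊥-elim)
open import Data.Fin as Fin using (Fin; zero; suc; fromℕ; opposite; punchIn; punchOut; #_)
import Data.Fin.Properties as Finₚ
open import Data.Integer using (ℤ; -[1+_])
import Data.Integer as ℤ
import Data.Integer.Properties as ℤₚ
import Data.Integer.Tactic.RingSolver as ℤ-Ring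
open import Data.List as List using ([]; _∷_; length; map; filter; _++_)
import Data.List.Properties as Listₚ
open import Data.List.Membership.Propositional using (_∈_)
import Data.List.Membership.Propositional.Properties as ∈ₚ
open import Data.List.Membership.Propositional.Properties.WithK using (unique∧set⇒bag)
open import Data.List.Relation.Binary.BagAndSetEquality using (∼bag⇒↭)
open import Data.List.Relation.Binary.Permutation.Propositional.Properties using (↭-length)
open import Data.List.Relation.Unary.All using ([])
open import Data.List.Relation.Unary.AllPairs using ([]; _∷_)
open import Data.List.Relation.Unary.Any using (here; there)
open import Data.List.Relation.Unary.Unique.Propositional using (Unique)
import Data.List.Relation.Unary.Unique.Propositional.Properties as Uniqueₚ
open import Data.Nat using (_+_)
import Data.Nat as ℕ
import Data.Nat.Properties as ℕₚ
open import Data.Nat.Tactic.RingSolver using (solve-∀)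
open import Data.Product using (∃; _×_; _,_; proj₁; proj₂)
open import Data.Sum as Sum using (_⊎_; inj₁; inj₂)
open import Data.Vec as Vec using (Vec; []; _∷_; lookup; tabulate)
import Data.Vec.Properties as Vecₚ
open import Data.Vec.Relation.Unary.Linked using (Linked; [-]; _∷_)
import Data.Vec.Relation.Unary.Linked.Properties as Linkedₚ
open import Function using (_∘_)
open import Function.Bundles using (_⇔_; mk⇔; Equivalence)
open import Function.Definitions using (Injective)
import Function.Properties.Equivalence as ⇔
open import Level using (0ℓ)
open import Relation.Binary.Definitions using (tri<; tri≈; tri>)
open import Relation.Binary.PropositionalEquality
  using (refl; sym; trans; cong; cong₂; subst; subst₂; _≢_; module ≡-Reasoning)
open import Relation.Nullary using (¬_; yes; no)
import Relation.Nullary.Decidable as Dec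
open import Relation.Nullary.Decidable using (_⊎-dec_)
open import Relation.Unary using (Pred; Decidable; _∩_; _∪_; ∁; _⊆_; ∅)
open import Relation.Unary.Properties using (∁?)

private
  variable
    k n : ℕ
    A B : Set
    P Q : Pred A 0ℓ

Image : (A → B) → Pred A 0ℓ → Pred B 0ℓ
Image f P y = ∃ λ x → P x × y ≡ f x

-- HasCount n k unfolds to HasSize (Counted n) k.
HasSize : Pred A 0ℓ → ℕ → Set
HasSize P k = ∃ λ xs → Unique xs × (∀ x → (x ∈ xs) ⇔ P x) × length xs ≡ k

size-unique : {a b : ℕ} → HasSize P a → HasSize P b → a ≡ b
size-unique (xs , xs! , ∈xs , refl) (ys , ys! , ∈ys , refl) =
  ↭-length (∼bag⇒↭ (unique∧set⇒bag xs! ys! (λ {x} → ⇔.trans (∈xs x) (⇔.sym (∈ys x)))))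

size-resp : {a : ℕ} → (∀ x → P x ⇔ Q x) → HasSize P a → HasSize Q a
size-resp P⇔Q (xs , xs! , ∈xs , len) = xs , xs! , (λ x → ⇔.trans (∈xs x) (P⇔Q x)) , len

size-image : {f : A → B} {a : ℕ} → Injective _≡_ _≡_ f → HasSize P a → HasSize (Image f P) a
size-image {f = f} f-inj (xs , xs! , ∈xs , len) =
  map f xs , Uniqueₚ.map⁺ f-inj xs! , (λ y → mk⇔
    (λ y∈ → let x , x∈xs , y≡fx = ∈ₚ.∈-map⁻ f y∈ in x , Equivalence.to (∈xs x) x∈xs , y≡fx)
    (λ { (x , Px , refl) → ∈ₚ.∈-map⁺ f (Equivalence.from (∈xs x) Px) })) ,
  trans (Listₚ.length-map f xs) len

size-∪ : {a b : ℕ} → P ∩ Q ⊆ ∅ → HasSize P a → HasSize Q b → HasSize (P ∪ Q) (a + b)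
size-∪ disjoint (xs , xs! , ∈xs , refl) (ys , ys! , ∈ys , refl) =
  xs ++ ys ,
  Uniqueₚ.++⁺ xs! ys! (λ (x∈xs , x∈ys) → disjoint (Equivalence.to (∈xs _) x∈xs , Equivalence.to (∈ys _) x∈ys)) ,
  (λ x → mk⇔
    (λ x∈ → Sum.map (Equivalence.to (∈xs x)) (Equivalence.to (∈ys x)) (∈ₚ.∈-++⁻ xs x∈))
    λ { (inj₁ Px) → ∈ₚ.∈-++⁺ˡ (Equivalence.from (∈xs x) Px)
      ; (inj₂ Qx) → ∈ₚ.∈-++⁺ʳ xs (Equivalence.from (∈ys x) Qx) }) ,
  Listₚ.length-++ xs

size-∩ : {a : ℕ} → Decidable Q → HasSize P a → ∃ λ b → HasSize (P ∩ Q) b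
size-∩ Q? (xs , xs! , ∈xs , _) = _ , filter Q? xs , Uniqueₚ.filter⁺ Q? xs! , (λ x → mk⇔
    (λ x∈ → let x∈xs , Qx = ∈ₚ.∈-filter⁻ Q? x∈ in Equivalence.to (∈xs x) x∈xs , Qx)
    (λ (Px , Qx) → ∈ₚ.∈-filter⁺ Q? (Equivalence.from (∈xs x) Px) Qx)) ,
  refl

size-split : {a b c : ℕ} → Decidable Q → HasSize (P ∩ Q) b → HasSize (P ∩ ∁ Q) c → HasSize P a → a ≡ b + c
size-split Q? P∩Q-size P∖Q-size P-size = size-unique P-size
  (size-resp (λ x → mk⇔ Sum.[ proj₁ , proj₁ ] (λ Px → Sum.map (Px ,_) (Px ,_) (Dec.toSum (Q? x))))
    (size-∪ (λ ((_ , Qx) , (_ , ¬Qx)) → ¬Qx Qx) P∩Q-size P∖Q-size))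

Perm : ℕ → Set
Perm n = Vec (Fin n) n

first last : Vec A (suc n) → A
first xs = lookup xs zero
last {n = n} xs = lookup xs (fromℕ n)

lookup-ext : {xs ys : Vec A n} → (∀ i → lookup xs i ≡ lookup ys i) → xs ≡ ys
lookup-ext {xs = xs} {ys} eq = begin
  xs                   ≡⟨ Vecₚ.tabulate∘lookup xs ⟨
  tabulate (lookup xs) ≡⟨ Vecₚ.tabulate-cong eq ⟩
  tabulate (lookup ys) ≡⟨ Vecₚ.tabulate∘lookup ys ⟩
  ys                   ∎
  where open ≡-Reasoning

injective⇒surjective : {f : Fin n → Fin n} → Injective _≡_ _≡_ f → ∀ y → ∃ λ i → f i ≡ y
injective⇒surjective {suc n} {f} f-inj y with Finₚ.any? (λ i → f i Fin.≟ y)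
... | yes hit = hit
... | no miss = ⊥-elim (Finₚ.<⇒notInjective (ℕₚ.n<1+n n) shrink-injective)
  where
  y≢f : ∀ i → y ≢ f i
  y≢f i eq = miss (i , sym eq)
  shrink-injective : Injective _≡_ _≡_ (λ i → punchOut (y≢f i))
  shrink-injective eq = f-inj (Finₚ.punchOut-injective (y≢f _) (y≢f _) eq)

IsExtreme : Fin (suc n) → Set
IsExtreme {n} v = v ≡ zero ⊎ v ≡ fromℕ n

isExtreme? : Decidable (IsExtreme {n})
isExtreme? v = (v Fin.≟ zero) ⊎-dec (v Fin.≟ fromℕ _)

extreme-not-between : {a v b : Fin (suc n)} → IsExtreme v → a Fin.< v → v Fin.< b → ⊥
extreme-not-between (inj₁ refl) a<0 _   = ℕₚ.n≮0 a<0
extreme-not-between (inj₂ refl) _   v<b = ℕₚ.<⇒≱ v<b (Finₚ.≤fromℕ _)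

interior⇒between : {x : Fin (suc n)} → ¬ IsExtreme x → zero {n} Fin.< x × x Fin.< fromℕ n
interior⇒between x-interior =
  Finₚ.≤∧≢⇒< ℕ.z≤n (x-interior ∘ inj₁ ∘ sym) , Finₚ.≤∧≢⇒< (Finₚ.≤fromℕ _) (x-interior ∘ inj₂)

StrictlyIncreasing : (Fin k → Fin n) → Set
StrictlyIncreasing f = ∀ i j → i Fin.< j → f i Fin.< f j

strictlyIncreasing⇒reflects-< : {f : Fin k → Fin n} → StrictlyIncreasing f →
                                 ∀ i j → f i Fin.< f j → i Fin.< j
strictlyIncreasing⇒reflects-< f↑ i j fi<fj with Finₚ.<-cmp i j
... | tri< i<j _ _ = i<j
... | tri≈ _ refl _ = ⊥-elim (Finₚ.<-irrefl refl fi<fj)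
... | tri> _ _ j<i = ⊥-elim (Finₚ.<-asym fi<fj (f↑ j i j<i))

contains-from-ascending : (σ : Vec (Fin n) n) (π : Vec (Fin k) k) (positions values : Vec (Fin n) k) →
                          Linked Fin._<_ positions → Linked Fin._<_ values →
                          (∀ i → lookup σ (lookup positions i) ≡ lookup values (lookup π i)) →
                          Contains σ π
contains-from-ascending σ π positions values positions↑ values↑ eq =
  lookup positions , ascending positions↑ , order-iso
  where
  ascending : ∀ {xs : Vec (Fin n) k} → Linked Fin._<_ xs → StrictlyIncreasing (lookup xs)
  ascending xs↑ i j = Linkedₚ.lookup⁺ Finₚ.<-trans xs↑
  order-iso : ∀ i j → (lookup σ (lookup positions i) Fin.< lookup σ (lookup positions j)) ⇔
                      (lookup π i Fin.< lookup π j)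
  order-iso i j rewrite eq i | eq j =
    mk⇔ (strictlyIncreasing⇒reflects-< (ascending values↑) _ _) (ascending values↑ _ _)

shorter-avoids : n ℕ.< k → (σ : Vec (Fin n) n) (π : Vec (Fin k) k) → Avoids σ π
shorter-avoids n<k σ π (f , f↑ , _) with Finₚ.pigeonhole n<k f
... | i , j , i<j , fi≡fj = Finₚ.<-irrefl fi≡fj (f↑ i j i<j)

ends-contain : ∀ {m} (σ : Perm (suc (suc m))) (π : Perm 4) (x y c d : Fin (suc (suc m))) →
               ¬ IsExtreme x → x Fin.< y → ¬ IsExtreme y → ¬ IsExtreme c → c Fin.< d → ¬ IsExtreme d →
               (∀ i → lookup σ (lookup (zero ∷ x ∷ y ∷ fromℕ (suc m) ∷ []) i) ≡
                      lookup (zero ∷ c ∷ d ∷ fromℕ (suc m) ∷ []) (lookup π i)) →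
               Contains σ π
ends-contain {m} σ π x y c d x-interior x<y y-interior c-interior c<d d-interior =
  contains-from-ascending σ π (zero ∷ x ∷ y ∷ fromℕ (suc m) ∷ []) (zero ∷ c ∷ d ∷ fromℕ (suc m) ∷ [])
    (proj₁ (interior⇒between x-interior) ∷ x<y ∷ proj₂ (interior⇒between y-interior) ∷ [-])
    (proj₁ (interior⇒between c-interior) ∷ c<d ∷ proj₂ (interior⇒between d-interior) ∷ [-])

rev : Vec A n → Vec A n
rev xs = tabulate (lookup xs ∘ opposite)

lookup-rev : (xs : Vec A n) → ∀ i → lookup (rev xs) i ≡ lookup xs (opposite i)
lookup-rev xs = Vecₚ.lookup∘tabulate (lookup xs ∘ opposite)

rev-involutive : (xs : Vec A n) → rev (rev xs) ≡ xs
rev-involutive xs = lookup-ext λ i → begin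
  lookup (rev (rev xs)) i           ≡⟨ lookup-rev (rev xs) i ⟩
  lookup (rev xs) (opposite i)      ≡⟨ lookup-rev xs (opposite i) ⟩
  lookup xs (opposite (opposite i)) ≡⟨ cong (lookup xs) (Finₚ.opposite-involutive i) ⟩
  lookup xs i                       ∎
  where open ≡-Reasoning

opposite-injective : Injective _≡_ _≡_ (opposite {n})
opposite-injective {x = i} {j} eq = begin
  i                     ≡⟨ Finₚ.opposite-involutive i ⟨
  opposite (opposite i) ≡⟨ cong opposite eq ⟩
  opposite (opposite j) ≡⟨ Finₚ.opposite-involutive j ⟩
  j                     ∎
  where open ≡-Reasoning

opposite-< : {i j : Fin n} → i Fin.< j → opposite j Fin.< opposite i
opposite-< {suc n} {i} {j} i<j rewrite Finₚ.opposite-prop i | Finₚ.opposite-prop j =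
  ℕₚ.∸-monoʳ-< (ℕ.s≤s i<j) (Finₚ.toℕ<n j)

isPerm-rev : (σ : Perm n) → IsPerm σ → IsPerm (rev σ)
isPerm-rev σ σ-inj {i} {j} eq =
  opposite-injective (σ-inj (trans (sym (lookup-rev σ i)) (trans eq (lookup-rev σ j))))

contains-rev : (σ : Vec (Fin n) n) (π : Vec (Fin k) k) → Contains σ π → Contains (rev σ) (rev π)
contains-rev {n = n} {k = k} σ π (f , f↑ , f-iso) = g , g↑ , g-iso
  where
  g : Fin k → Fin n
  g = opposite ∘ f ∘ opposite
  g↑ : StrictlyIncreasing g
  g↑ i j i<j = opposite-< (f↑ _ _ (opposite-< i<j))
  rev-σ∘g : ∀ i → lookup (rev σ) (g i) ≡ lookup σ (f (opposite i))
  rev-σ∘g i = trans (lookup-rev σ (g i)) (cong (lookup σ) (Finₚ.opposite-involutive _))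
  g-iso : ∀ i j → (lookup (rev σ) (g i) Fin.< lookup (rev σ) (g j)) ⇔ (lookup (rev π) i Fin.< lookup (rev π) j)
  g-iso i j rewrite rev-σ∘g i | rev-σ∘g j | lookup-rev π i | lookup-rev π j = f-iso (opposite i) (opposite j)

avoids-rev : (σ : Perm n) (π : Perm k) → Avoids σ (rev π) → Avoids (rev σ) π
avoids-rev σ π σ-avoids occurrence =
  σ-avoids (subst (λ τ → Contains τ (rev π)) (rev-involutive σ) (contains-rev (rev σ) π occurrence))

prepend : Fin (suc n) → Perm n → Perm (suc n)
prepend v τ = v ∷ Vec.map (punchIn v) τ

lookup-prepend : (v : Fin (suc n)) (τ : Perm n) → ∀ i → lookup (prepend v τ) (suc i) ≡ punchIn v (lookup τ i)
lookup-prepend v τ i = Vecₚ.lookup-map i (punchIn v) τ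

punchIn-<-⇔ : (v : Fin (suc n)) {a b : Fin n} → (punchIn v a Fin.< punchIn v b) ⇔ (a Fin.< b)
punchIn-<-⇔ v {a} {b} = mk⇔
  (λ va<vb → ℕₚ.≰⇒> (λ b≤a → ℕₚ.<⇒≱ va<vb (Finₚ.punchIn-mono-≤ v b a b≤a)))
  (λ a<b → ℕₚ.≰⇒> (λ vb≤va → ℕₚ.<⇒≱ a<b (Finₚ.punchIn-cancel-≤ v b a vb≤va)))

isPerm-prepend : (v : Fin (suc n)) {τ : Perm n} → IsPerm τ → IsPerm (prepend v τ)
isPerm-prepend v     τ-inj {zero}  {zero}  _  = refl
isPerm-prepend v {τ} τ-inj {zero}  {suc j} eq =
  ⊥-elim (Finₚ.punchInᵢ≢i v (lookup τ j) (sym (trans eq (lookup-prepend v τ j))))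
isPerm-prepend v {τ} τ-inj {suc i} {zero}  eq =
  ⊥-elim (Finₚ.punchInᵢ≢i v (lookup τ i) (trans (sym (lookup-prepend v τ i)) eq))
isPerm-prepend v {τ} τ-inj {suc i} {suc j} eq = cong suc (τ-inj (Finₚ.punchIn-injective v _ _
  (trans (sym (lookup-prepend v τ i)) (trans eq (lookup-prepend v τ j)))))

prepend-injective : (v : Fin (suc n)) → Injective _≡_ _≡_ (prepend v)
prepend-injective v {τ} {τ′} eq = lookup-ext λ i → Finₚ.punchIn-injective v _ _ (begin
  punchIn v (lookup τ i)         ≡⟨ lookup-prepend v τ i ⟨
  lookup (prepend v τ) (suc i)   ≡⟨ cong (λ σ → lookup σ (suc i)) eq ⟩
  lookup (prepend v τ′) (suc i)  ≡⟨ lookup-prepend v τ′ i ⟩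
  punchIn v (lookup τ′ i)        ∎)
  where open ≡-Reasoning

prepend-view : (σ : Perm (suc n)) → IsPerm σ → ∃ λ τ → IsPerm τ × σ ≡ prepend (first σ) τ
prepend-view {n} σ σ-inj = τ , τ-inj , lookup-ext σ≗
  where
  first≢ : ∀ i → first σ ≢ lookup σ (suc i)
  first≢ i eq with () ← σ-inj eq
  τ : Perm n
  τ = tabulate (λ i → punchOut (first≢ i))
  lookup-τ : ∀ i → lookup τ i ≡ punchOut (first≢ i)
  lookup-τ = Vecₚ.lookup∘tabulate _
  τ-inj : IsPerm τ
  τ-inj {i} {j} eq with refl ← σ-inj (Finₚ.punchOut-injective (first≢ i) (first≢ j)
    (trans (sym (lookup-τ i)) (trans eq (lookup-τ j)))) = refl
  σ≗ : ∀ i → lookup σ i ≡ lookup (prepend (first σ) τ) i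
  σ≗ zero    = refl
  σ≗ (suc i) = sym (begin
    lookup (prepend (first σ) τ) (suc i) ≡⟨ lookup-prepend (first σ) τ i ⟩
    punchIn (first σ) (lookup τ i)       ≡⟨ cong (punchIn (first σ)) (lookup-τ i) ⟩
    punchIn (first σ) (punchOut (first≢ i)) ≡⟨ Finₚ.punchIn-punchOut (first≢ i) ⟩
    lookup σ (suc i)                     ∎)
    where open ≡-Reasoning

contains-prepend⁺ : (v : Fin (suc n)) {τ : Perm n} {π : Vec (Fin k) k} → Contains τ π → Contains (prepend v τ) π
contains-prepend⁺ v {τ} {π} (f , f↑ , f-iso) = suc ∘ f , (λ i j i<j → ℕ.s<s (f↑ i j i<j)) , g-iso
  where
  g-iso : ∀ i j → (lookup (prepend v τ) (suc (f i)) Fin.< lookup (prepend v τ) (suc (f j))) ⇔ (lookup π i Fin.< lookup π j)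
  g-iso i j rewrite lookup-prepend v τ (f i) | lookup-prepend v τ (f j) = ⇔.trans (punchIn-<-⇔ v) (f-iso i j)

HeadInterior : Perm (suc k) → Set
HeadInterior π = (∃ λ a → lookup π a Fin.< first π) × (∃ λ b → first π Fin.< lookup π b)

-- An extreme value cannot play the role of the interior head of π, so the occurrence
-- avoids position 0.
contains-prepend⁻ : {v : Fin (suc n)} {τ : Perm n} {π : Perm (suc k)} → IsExtreme v → HeadInterior π →
                    Contains (prepend v τ) π → Contains τ π
contains-prepend⁻ {n} {k} {v} {τ} {π} ext ((a , πa<π₀) , (b , π₀<πb)) (f , f↑ , f-iso) with f zero in f₀≡
... | zero = ⊥-elim (extreme-not-between ext
        (subst (lookup (prepend v τ) (f a) Fin.<_) v≡ (Equivalence.from (f-iso a zero) πa<π₀))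
        (subst (Fin._< lookup (prepend v τ) (f b)) v≡ (Equivalence.from (f-iso zero b) π₀<πb)))
  where
  v≡ : lookup (prepend v τ) (f zero) ≡ v
  v≡ = cong (lookup (prepend v τ)) f₀≡
... | suc _ = g , g↑ , g-iso
  where
  positive : ∀ i → zero ≢ f i
  positive zero    0≡f₀ = Finₚ.0≢1+n (trans 0≡f₀ f₀≡)
  positive (suc i) 0≡fi = ℕₚ.n≮0 (subst (f zero Fin.<_) (sym 0≡fi) (f↑ zero (suc i) ℕ.z<s))
  g : Fin (suc k) → Fin n
  g i = punchOut (positive i)
  suc∘g : ∀ i → suc (g i) ≡ f i
  suc∘g i = Finₚ.punchIn-punchOut (positive i)
  g↑ : StrictlyIncreasing g
  g↑ i j i<j = ℕ.s<s⁻¹ (subst₂ Fin._<_ (sym (suc∘g i)) (sym (suc∘g j)) (f↑ i j i<j))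
  value : ∀ i → lookup (prepend v τ) (f i) ≡ punchIn v (lookup τ (g i))
  value i = trans (cong (lookup (prepend v τ)) (sym (suc∘g i))) (lookup-prepend v τ (g i))
  g-iso : ∀ i j → (lookup τ (g i) Fin.< lookup τ (g j)) ⇔ (lookup π i Fin.< lookup π j)
  g-iso i j = ⇔.trans (⇔.sym (punchIn-<-⇔ v)) (subst₂ (λ x y → (x Fin.< y) ⇔ _) (value i) (value j) (f-iso i j))

append : Fin (suc n) → Perm n → Perm (suc n)
append v ρ = rev (prepend v (rev ρ))

first-append : ∀ {m} (v : Fin (suc (suc m))) (ρ : Perm (suc m)) → first (append v ρ) ≡ punchIn v (first ρ)
first-append {m} v ρ = begin
  first (append v ρ)                   ≡⟨ lookup-prepend v (rev ρ) (fromℕ m) ⟩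
  punchIn v (lookup (rev ρ) (fromℕ m)) ≡⟨ cong (punchIn v ∘ first) (rev-involutive ρ) ⟩
  punchIn v (first ρ)                  ∎
  where open ≡-Reasoning

append-injective : (v : Fin (suc n)) → Injective _≡_ _≡_ (append v)
append-injective v {ρ} {ρ′} eq = begin
  ρ             ≡⟨ rev-involutive ρ ⟨
  rev (rev ρ)   ≡⟨ cong rev (prepend-injective v (begin
    prepend v (rev ρ)             ≡⟨ rev-involutive _ ⟨
    rev (append v ρ)              ≡⟨ cong rev eq ⟩
    rev (append v ρ′)             ≡⟨ rev-involutive _ ⟩
    prepend v (rev ρ′)            ∎)) ⟩
  rev (rev ρ′)  ≡⟨ rev-involutive ρ′ ⟩
  ρ′            ∎
  where open ≡-Reasoning

last-append : (v : Fin (suc n)) (ρ : Perm n) → last (append v ρ) ≡ v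
last-append v ρ = cong first (rev-involutive (prepend v (rev ρ)))

-- rev p2413 = p3142 and rev p2143 = p3412 hold by computation.
counted-rev : (σ : Perm n) → Counted n σ → Counted n (rev σ)
counted-rev σ (σ-perm , ¬2413 , ¬3142 , ¬2143 , ¬3412) =
  isPerm-rev σ σ-perm , avoids-rev σ p2413 ¬3142 , avoids-rev σ p3142 ¬2413 ,
  avoids-rev σ p2143 ¬3412 , avoids-rev σ p3412 ¬2143

counted-prepend⁺ : {v : Fin (suc n)} {τ : Perm n} → IsExtreme v → Counted n τ → Counted (suc n) (prepend v τ)
counted-prepend⁺ {v = v} ext (τ-perm , ¬2413 , ¬3142 , ¬2143 , ¬3412) =
  isPerm-prepend v τ-perm ,
  ¬2413 ∘ contains-prepend⁻ {π = p2413} ext ((# 2 , ℕ.z<s) , (# 1 , ℕ.s<s ℕ.z<s)) ,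
  ¬3142 ∘ contains-prepend⁻ {π = p3142} ext ((# 1 , ℕ.z<s) , (# 2 , ℕ.s<s (ℕ.s<s ℕ.z<s))) ,
  ¬2143 ∘ contains-prepend⁻ {π = p2143} ext ((# 1 , ℕ.z<s) , (# 2 , ℕ.s<s ℕ.z<s)) ,
  ¬3412 ∘ contains-prepend⁻ {π = p3412} ext ((# 2 , ℕ.z<s) , (# 1 , ℕ.s<s (ℕ.s<s ℕ.z<s)))

counted-prepend⁻ : {v : Fin (suc n)} {τ : Perm n} → IsPerm τ → Counted (suc n) (prepend v τ) → Counted n τ
counted-prepend⁻ {v = v} τ-perm (_ , ¬2413 , ¬3142 , ¬2143 , ¬3412) =
  τ-perm , ¬2413 ∘ contains-prepend⁺ v {π = p2413} , ¬3142 ∘ contains-prepend⁺ v {π = p3142} ,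
  ¬2143 ∘ contains-prepend⁺ v {π = p2143} , ¬3412 ∘ contains-prepend⁺ v {π = p3412}

counted-short : n ℕ.< 4 → (σ : Perm n) → IsPerm σ → Counted n σ
counted-short n<4 σ σ-perm =
  σ-perm , shorter-avoids n<4 σ p2413 , shorter-avoids n<4 σ p3142 ,
  shorter-avoids n<4 σ p2143 , shorter-avoids n<4 σ p3412

interior-ends⇒contains : ∀ {m} (σ : Perm (suc (suc m))) → IsPerm σ →
                         ¬ IsExtreme (first σ) → ¬ IsExtreme (last σ) →
                         Contains σ p2413 ⊎ Contains σ p3142 ⊎ Contains σ p2143 ⊎ Contains σ p3412
interior-ends⇒contains {m} σ σ-perm first-interior last-interior
  with injective⇒surjective σ-perm zero | injective⇒surjective σ-perm (fromℕ (suc m))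
... | p , σp≡0 | q , σq≡top = by-order
  where
  p-interior : ¬ IsExtreme p
  p-interior (inj₁ refl) = first-interior (inj₁ σp≡0)
  p-interior (inj₂ refl) = last-interior (inj₁ σp≡0)
  q-interior : ¬ IsExtreme q
  q-interior (inj₁ refl) = first-interior (inj₂ σq≡top)
  q-interior (inj₂ refl) = last-interior (inj₂ σq≡top)

  by-order : Contains σ p2413 ⊎ Contains σ p3142 ⊎ Contains σ p2143 ⊎ Contains σ p3412
  by-order with Finₚ.<-cmp p q | Finₚ.<-cmp (first σ) (last σ)
  ... | tri≈ _ refl _ | _ = ⊥-elim (Finₚ.0≢1+n (trans (sym σp≡0) σq≡top))
  ... | _ | tri≈ _ b≡z _ with () ← σ-perm b≡z
  ... | tri< p<q _ _ | tri< b<z _ _ = inj₂ (inj₂ (inj₁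
    (ends-contain σ p2143 p q (first σ) (last σ) p-interior p<q q-interior first-interior b<z last-interior
      λ { zero → refl ; (suc zero) → σp≡0 ; (suc (suc zero)) → σq≡top ; (suc (suc (suc zero))) → refl })))
  ... | tri< p<q _ _ | tri> _ _ z<b = inj₂ (inj₁
    (ends-contain σ p3142 p q (last σ) (first σ) p-interior p<q q-interior last-interior z<b first-interior
      λ { zero → refl ; (suc zero) → σp≡0 ; (suc (suc zero)) → σq≡top ; (suc (suc (suc zero))) → refl }))
  ... | tri> _ _ q<p | tri< b<z _ _ = inj₁
    (ends-contain σ p2413 q p (first σ) (last σ) q-interior q<p p-interior first-interior b<z last-interior
      λ { zero → refl ; (suc zero) → σq≡top ; (suc (suc zero)) → σp≡0 ; (suc (suc (suc zero))) → refl })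
  ... | tri> _ _ q<p | tri> _ _ z<b = inj₂ (inj₂ (inj₂
    (ends-contain σ p3412 q p (last σ) (first σ) q-interior q<p p-interior last-interior z<b first-interior
      λ { zero → refl ; (suc zero) → σq≡top ; (suc (suc zero)) → σp≡0 ; (suc (suc (suc zero))) → refl })))

extreme-at-an-end : ∀ {m} (σ : Perm (suc (suc m))) → Counted _ σ → IsExtreme (first σ) ⊎ IsExtreme (last σ)
extreme-at-an-end σ (σ-perm , ¬2413 , ¬3142 , ¬2143 , ¬3412) with isExtreme? (first σ) | isExtreme? (last σ)
... | yes first-extreme | _                = inj₁ first-extreme
... | no _              | yes last-extreme = inj₂ last-extreme
... | no first-interior | no last-interior =
  ⊥-elim (Sum.[ ¬2413 , Sum.[ ¬3142 , Sum.[ ¬2143 , ¬3412 ] ] ]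
    (interior-ends⇒contains σ σ-perm first-interior last-interior))

counted-first⇔ : {v : Fin (suc n)} → IsExtreme v →
                 ∀ σ → (Counted (suc n) σ × first σ ≡ v) ⇔ Image (prepend v) (Counted n) σ
counted-first⇔ {v = v} ext σ = mk⇔ to from
  where
  to : Counted _ σ × first σ ≡ v → Image (prepend v) (Counted _) σ
  to (σ-counted , refl) =
    let τ , τ-perm , σ≡ = prepend-view σ (proj₁ σ-counted)
    in τ , counted-prepend⁻ τ-perm (subst (Counted _) σ≡ σ-counted) , σ≡
  from : Image (prepend v) (Counted _) σ → Counted _ σ × first σ ≡ v
  from (τ , τ-counted , refl) = counted-prepend⁺ ext τ-counted , refl

-- last σ and first (rev σ) agree by computation.
counted-last⇔ : {v : Fin (suc n)} → IsExtreme v →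
                ∀ σ → (Counted (suc n) σ × last σ ≡ v) ⇔ Image (append v) (Counted n) σ
counted-last⇔ {v = v} ext σ = mk⇔ to from
  where
  to : Counted _ σ × last σ ≡ v → Image (append v) (Counted _) σ
  to (σ-counted , last≡v) =
    let τ , τ-counted , rev-σ≡ = Equivalence.to (counted-first⇔ ext (rev σ)) (counted-rev σ σ-counted , last≡v)
    in rev τ , counted-rev τ τ-counted , (begin
      σ                             ≡⟨ rev-involutive σ ⟨
      rev (rev σ)                   ≡⟨ cong rev rev-σ≡ ⟩
      rev (prepend v τ)             ≡⟨ cong (rev ∘ prepend v) (rev-involutive τ) ⟨
      rev (prepend v (rev (rev τ))) ∎)
    where open ≡-Reasoning
  from : Image (append v) (Counted _) σ → Counted _ σ × last σ ≡ v
  from (ρ , ρ-counted , refl) =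
    counted-rev (prepend v (rev ρ)) (counted-prepend⁺ ext (counted-rev ρ ρ-counted)) , last-append v ρ

StartsWith : Fin (suc n) → Pred (Perm (suc n)) 0ℓ
StartsWith v σ = first σ ≡ v

startsWith? : (v : Fin (suc n)) → Decidable (StartsWith v)
startsWith? v σ = first σ Fin.≟ v

Prepended : ∀ {m} → Fin (suc (suc m)) → Pred (Perm (suc (suc m))) 0ℓ
Prepended {m} v = Image (prepend v) (Counted (suc m))

Appended : ∀ {m} → Fin (suc (suc m)) → Fin (suc m) → Pred (Perm (suc (suc m))) 0ℓ
Appended {m} v w = Image (append v) (Counted (suc m) ∩ ∁ (StartsWith w))

-- Excluding the first value w that punchIn v would send to the other extreme keeps the
-- first entry of the appended parts interior, which makes the four parts disjoint.
Decomposed : ∀ m → Pred (Perm (suc (suc m))) 0ℓ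
Decomposed m = Prepended zero ∪ Prepended (fromℕ (suc m)) ∪ Appended zero (fromℕ m) ∪ Appended (fromℕ (suc m)) zero

appended-zero-first-interior : ∀ {m} (ρ : Perm (suc m)) → first ρ ≢ fromℕ m → ¬ IsExtreme (first (append zero ρ))
appended-zero-first-interior ρ ρ₀≢top rewrite first-append zero ρ = λ
  { (inj₁ ())
  ; (inj₂ e) → ρ₀≢top (Finₚ.suc-injective e) }

appended-top-first-interior : ∀ {m} (ρ : Perm (suc m)) → first ρ ≢ zero →
                              ¬ IsExtreme (first (append (fromℕ (suc m)) ρ))
appended-top-first-interior {m} ρ ρ₀≢0 rewrite first-append (fromℕ (suc m)) ρ = λ
  { (inj₁ e) → ρ₀≢0 (Finₚ.punchIn-injective (fromℕ (suc m)) (first ρ) zero e)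
  ; (inj₂ e) → Finₚ.punchInᵢ≢i (fromℕ (suc m)) (first ρ) e }

counted⇔decomposed : ∀ {m} σ → Counted (suc (suc m)) σ ⇔ Decomposed m σ
counted⇔decomposed {m} σ = mk⇔ to from
  where
  open ≡-Reasoning
  top : Fin (suc (suc m))
  top = fromℕ (suc m)
  by-last : Counted _ σ → first σ ≢ zero → first σ ≢ top → IsExtreme (first σ) ⊎ IsExtreme (last σ) →
            (Appended zero (fromℕ m) ∪ Appended top zero) σ
  by-last _ first≢0 first≢top (inj₁ first-extreme) = ⊥-elim (Sum.[ first≢0 , first≢top ] first-extreme)
  by-last σ-counted _ first≢top (inj₂ (inj₁ last≡0)) =
    let ρ , ρ-counted , σ≡ = Equivalence.to (counted-last⇔ (inj₁ refl) σ) (σ-counted , last≡0)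
    in inj₁ (ρ , (ρ-counted , λ ρ₀≡top → first≢top (begin
      first σ                 ≡⟨ cong first σ≡ ⟩
      first (append zero ρ)   ≡⟨ first-append zero ρ ⟩
      suc (first ρ)           ≡⟨ cong suc ρ₀≡top ⟩
      top                     ∎)) , σ≡)
  by-last σ-counted first≢0 _ (inj₂ (inj₂ last≡top)) =
    let ρ , ρ-counted , σ≡ = Equivalence.to (counted-last⇔ (inj₂ refl) σ) (σ-counted , last≡top)
    in inj₂ (ρ , (ρ-counted , λ ρ₀≡0 → first≢0 (begin
      first σ                 ≡⟨ cong first σ≡ ⟩
      first (append top ρ)    ≡⟨ first-append top ρ ⟩
      punchIn top (first ρ)   ≡⟨ cong (punchIn top) ρ₀≡0 ⟩
      zero                    ∎)) , σ≡)
  to : Counted _ σ → Decomposed m σ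
  to σ-counted with first σ Fin.≟ zero | first σ Fin.≟ top
  ... | yes first≡0 | _             = inj₁ (Equivalence.to (counted-first⇔ (inj₁ refl) σ) (σ-counted , first≡0))
  ... | no _        | yes first≡top = inj₂ (inj₁ (Equivalence.to (counted-first⇔ (inj₂ refl) σ) (σ-counted , first≡top)))
  ... | no first≢0  | no first≢top  =
    inj₂ (inj₂ (by-last σ-counted first≢0 first≢top (extreme-at-an-end σ σ-counted)))
  from : Decomposed m σ → Counted _ σ
  from (inj₁ prepended) = proj₁ (Equivalence.from (counted-first⇔ (inj₁ refl) σ) prepended)
  from (inj₂ (inj₁ prepended)) = proj₁ (Equivalence.from (counted-first⇔ (inj₂ refl) σ) prepended)
  from (inj₂ (inj₂ (inj₁ (ρ , (ρ-counted , _) , σ≡)))) =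
    proj₁ (Equivalence.from (counted-last⇔ (inj₁ refl) σ) (ρ , ρ-counted , σ≡))
  from (inj₂ (inj₂ (inj₂ (ρ , (ρ-counted , _) , σ≡)))) =
    proj₁ (Equivalence.from (counted-last⇔ (inj₂ refl) σ) (ρ , ρ-counted , σ≡))

size-decomposed : ∀ {m b x y} → HasCount (suc m) b →
                  HasSize (Counted (suc m) ∩ ∁ (StartsWith (fromℕ m))) x →
                  HasSize (Counted (suc m) ∩ ∁ (StartsWith zero)) y →
                  HasSize (Decomposed m) (b + (b + (x + y)))
size-decomposed {m} b-size x-size y-size =
  size-∪ disjoint₁ (size-image (prepend-injective zero) b-size)
    (size-∪ disjoint₂ (size-image (prepend-injective top) b-size)
      (size-∪ disjoint₃ (size-image (append-injective zero) x-size) (size-image (append-injective top) y-size)))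
  where
  top : Fin (suc (suc m))
  top = fromℕ (suc m)
  disjoint₁ : Prepended zero ∩ (Prepended top ∪ Appended zero (fromℕ m) ∪ Appended top zero) ⊆ ∅
  disjoint₁ ((_ , _ , refl) , inj₁ (_ , _ , σ≡))                   = Finₚ.0≢1+n (cong first σ≡)
  disjoint₁ ((_ , _ , refl) , inj₂ (inj₁ (ρ , (_ , ρ₀≢top) , σ≡))) =
    appended-zero-first-interior ρ ρ₀≢top (inj₁ (sym (cong first σ≡)))
  disjoint₁ ((_ , _ , refl) , inj₂ (inj₂ (ρ , (_ , ρ₀≢0) , σ≡)))   =
    appended-top-first-interior ρ ρ₀≢0 (inj₁ (sym (cong first σ≡)))
  disjoint₂ : Prepended top ∩ (Appended zero (fromℕ m) ∪ Appended top zero) ⊆ ∅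
  disjoint₂ ((_ , _ , refl) , inj₁ (ρ , (_ , ρ₀≢top) , σ≡)) =
    appended-zero-first-interior ρ ρ₀≢top (inj₂ (sym (cong first σ≡)))
  disjoint₂ ((_ , _ , refl) , inj₂ (ρ , (_ , ρ₀≢0) , σ≡))   =
    appended-top-first-interior ρ ρ₀≢0 (inj₂ (sym (cong first σ≡)))
  disjoint₃ : Appended zero (fromℕ m) ∩ Appended top zero ⊆ ∅
  disjoint₃ ((ρ , _ , refl) , (ρ′ , _ , σ≡)) =
    Finₚ.0≢1+n (trans (sym (last-append zero ρ)) (trans (cong last σ≡) (last-append top ρ′)))

size-counted-first : ∀ {a} {v : Fin (suc n)} → IsExtreme v → HasCount n a →
                     HasSize (Counted (suc n) ∩ StartsWith v) a
size-counted-first {v = v} ext =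
  size-resp (λ σ → ⇔.sym (counted-first⇔ ext σ)) ∘ size-image (prepend-injective v)

-- Subtraction-free form of c = 4b - 2a, in the shape of the coefficients of denom ⊛ s.
recurrence-arithmetic : ∀ a b c x y → c ≡ b + (b + (x + y)) → b ≡ a + x → b ≡ a + y →
                        c + (a + a) ≡ b + (b + (b + b))
recurrence-arithmetic a _ _ x _ refl refl a+x≡a+y with refl ← ℕₚ.+-cancelˡ-≡ a x _ a+x≡a+y = identity a x
  where
  identity : ∀ a x → a + x + (a + x + (x + x)) + (a + a) ≡ a + x + (a + x + (a + x + (a + x)))
  identity = solve-∀

count-recurrence : ∀ {m a b c} → HasCount m a → HasCount (suc m) b → HasCount (suc (suc m)) c →
                   c + (a + a) ≡ b + (b + (b + b))
count-recurrence {m} {a} {b} {c} a-size b-size c-size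
  with size-∩ (∁? (startsWith? (fromℕ m))) b-size | size-∩ (∁? (startsWith? zero)) b-size
... | x , x-size | y , y-size = recurrence-arithmetic a b c x y
  (size-unique c-size (size-resp (λ σ → ⇔.sym (counted⇔decomposed σ)) (size-decomposed b-size x-size y-size)))
  (size-split (startsWith? (fromℕ m)) (size-counted-first (inj₂ refl) a-size) x-size b-size)
  (size-split (startsWith? zero) (size-counted-first (inj₁ refl) a-size) y-size b-size)

size-singleton : {x : A} → (∀ y → P y ⇔ y ≡ x) → HasSize P 1
size-singleton {x = x} P⇔≡x =
  x ∷ [] , [] ∷ [] , (λ y → ⇔.trans (mk⇔ (λ { (here y≡x) → y≡x ; (there ()) }) here) (⇔.sym (P⇔≡x y))) , refl

count₀ : HasCount 0 1
count₀ = size-singleton λ { [] → mk⇔ (λ _ → refl) (λ _ → counted-short ℕ.z<s [] λ { {()} }) }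

count₁ : HasCount 1 1
count₁ = size-singleton λ
  { (zero ∷ []) → mk⇔ (λ _ → refl) (λ _ → counted-short (ℕ.s<s ℕ.z<s) (zero ∷ []) λ { {zero} {zero} _ → refl }) }

count₂ : ∀ {c} → HasCount 2 c → c ≡ 2
count₂ c-size = ℕₚ.+-cancelʳ-≡ 2 _ 2 (count-recurrence count₀ count₁ c-size)

sumℤ-vanishing : (f : ℕ → ℤ) (g : ℕ → ℕ) → (∀ i → f (g i) ≡ + 0) → ∀ k → sumℤ (map f (List.applyUpTo g k)) ≡ + 0
sumℤ-vanishing f g f∘g≡0 0       = refl
sumℤ-vanishing f g f∘g≡0 (suc k) = cong₂ ℤ._+_ (f∘g≡0 0) (sumℤ-vanishing f (g ∘ suc) (f∘g≡0 ∘ suc) k)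

denom-⊛ : ∀ (f : Series) k → (denom ⊛ f) (2 + k) ≡
          (f (2 + k) ℤ.+ (f k ℤ.+ f k)) ℤ.- (f (1 + k) ℤ.+ (f (1 + k) ℤ.+ (f (1 + k) ℤ.+ f (1 + k))))
denom-⊛ f k = begin
  (denom ⊛ f) (2 + k)
    ≡⟨ cong (λ t → + 1 ℤ.* f (2 + k) ℤ.+ (-[1+ 3 ] ℤ.* f (1 + k) ℤ.+ (+ 2 ℤ.* f k ℤ.+ t)))
            (sumℤ-vanishing _ (λ i → 3 + i) (λ _ → refl) k) ⟩
  + 1 ℤ.* f (2 + k) ℤ.+ (-[1+ 3 ] ℤ.* f (1 + k) ℤ.+ (+ 2 ℤ.* f k ℤ.+ + 0))
    ≡⟨ identity (f (2 + k)) (f (1 + k)) (f k) ⟩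
  (f (2 + k) ℤ.+ (f k ℤ.+ f k)) ℤ.- (f (1 + k) ℤ.+ (f (1 + k) ℤ.+ (f (1 + k) ℤ.+ f (1 + k)))) ∎
  where
  open ≡-Reasoning
  identity : ∀ x y z → + 1 ℤ.* x ℤ.+ (-[1+ 3 ] ℤ.* y ℤ.+ (+ 2 ℤ.* z ℤ.+ + 0)) ≡
                       (x ℤ.+ (z ℤ.+ z)) ℤ.- (y ℤ.+ (y ℤ.+ (y ℤ.+ y)))
  identity = ℤ-Ring.solve-∀

mainTheorem16 : (s : ℕ → ℕ) → (∀ n → HasCount n (s n)) →
    ∀ m → (denom ⊛ (λ n → + s (suc n))) m ≡ numer m
mainTheorem16 s counts 0 rewrite size-unique (counts 1) count₁ = refl
mainTheorem16 s counts 1 rewrite count₂ (counts 2) | size-unique (counts 1) count₁ = refl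
mainTheorem16 s counts (suc (suc k)) = begin
  (denom ⊛ coefficient) (2 + k)                             ≡⟨ denom-⊛ coefficient k ⟩
  + (s (3 + k) + (s (1 + k) + s (1 + k))) ℤ.- + four-s₂₊ₖ    ≡⟨ cong (λ t → + t ℤ.- + four-s₂₊ₖ) recurrence ⟩
  + four-s₂₊ₖ ℤ.- + four-s₂₊ₖ                               ≡⟨ ℤₚ.+-inverseʳ (+ four-s₂₊ₖ) ⟩
  + 0                                                       ∎
  where
  open ≡-Reasoning
  coefficient : Series
  coefficient n = + s (suc n)
  four-s₂₊ₖ : ℕ
  four-s₂₊ₖ = s (2 + k) + (s (2 + k) + (s (2 + k) + s (2 + k)))
  recurrence : s (3 + k) + (s (1 + k) + s (1 + k)) ≡ four-s₂₊ₖ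
  recurrence = count-recurrence (counts (1 + k)) (counts (2 + k)) (counts (3 + k))
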